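{- Let $p$ be a prime, $m$ a rational number and $n\ge0$ an integer. Then $$\int_{\mathbb{Z}_p}\binom{mx}{n}\,d\mu_1(x)=\sum_{k=0}^{n}\frac{(-1)^k}{k+1}\sum_{j=0}^{k}(-1)^j\binom{k}{j}\binom{mk-mj}{n}.$$
   Context: The Volkenborn integral of a polynomial function $f:\mathbb{Z}_p\to\mathbb{Q}_p$ is $\int_{\mathbb{Z}_p}f(x)\,d\mu_1(x)=\lim_{N\to\infty}p^{ -N}\sum_{x=0}^{p^N-1}f(x)$. For $y$ in a field of characteristic $0$ (or a variable) and integer $n\ge0$, $\binom{y}{n}=\frac{y(y-1)\cdots(y-n+1)}{n!}$. -}

module Defs where

open import Data.Nat as ℕ using (ℕ; zero; suc; _^_; _≤_; _!)
open import Data.Nat.Properties using (m^n≢0; _!≢0)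
open import Data.Nat.Combinatorics using (_C_)
open import Data.Nat.Divisibility using (_∣_)
open import Data.Nat.Primality using (Prime; prime⇒nonZero)
open import Data.Integer as ℤ using (ℤ; +_; ∣_∣)
open import Data.Rational as ℚ using (ℚ; _+_; _*_; _-_; -_; _/_; 0ℚ; 1ℚ; ↥_)
open import Data.Product using (∃)

nat : ℕ → ℚ
nat n = (+ n) / 1

sgn : ℕ → ℚ
sgn zero    = 1ℚ
sgn (suc k) = - sgn k

sumBelow : ℕ → (ℕ → ℚ) → ℚ
sumBelow zero    f = 0ℚ
sumBelow (suc n) f = sumBelow n f + f n

falling : ℚ → ℕ → ℚ
falling y zero    = 1ℚ
falling y (suc n) = falling y n * (y - nat n)

binom : ℚ → ℕ → ℚ
binom y n = falling y n * ((+ 1) / (n !))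
  where instance _ = n !≢0

-- p-adic valuation of q is at least k  (q = 0 counts as valuation ∞):
-- for q in lowest terms this is p^k ∣ numerator q
ValAtLeast : (p k : ℕ) → ℚ → Set
ValAtLeast p k q = (p ^ k) ∣ ∣ ↥ q ∣

PAdicLimit : (p : ℕ) → (ℕ → ℚ) → ℚ → Set
PAdicLimit p a L = ∀ (k : ℕ) → ∃ λ N₀ → ∀ (N : ℕ) → N₀ ≤ N → ValAtLeast p k (a N - L)

volkenbornSum : (p : ℕ) → Prime p → (ℕ → ℚ) → ℕ → ℚ
volkenbornSum p pp f N = ((+ 1) / (p ^ N)) * sumBelow (p ^ N) f
  where instance
    _ = prime⇒nonZero pp
    _ = m^n≢0 p N

VolkenbornIntegral : (p : ℕ) → Prime p → (ℕ → ℚ) → ℚ → Set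
VolkenbornIntegral p pp f L = PAdicLimit p (volkenbornSum p pp f) L

{-# OPTIONS --safe #-}
-- Put f x = binom (m x) n, a polynomial of degree n in x. Newton's forward-difference
-- formula evaluates the Riemann sums exactly: with M = p^N,
--   M⁻¹ Σ_{x<M} f x = Σ_{k≤n} M⁻¹ C(M, k+1) Δᵏf(0),
-- and Δᵏf(0) is the inner alternating sum of the statement. Since
--   (k+1)! (M⁻¹ C(M, k+1) − (−1)ᵏ/(k+1)) = (M−1)(M−2)⋯(M−k) − (−1)ᵏ k! ≡ 0 (mod M)
-- and den(m)ⁿ n! Δᵏf(0) is an integer, the error of the N-th Riemann sum times a constant
-- c independent of N is p^N times an integer, so its numerator is divisible by p^(N − c).
module Submission where

open import Defs
open import Data.Integer as ℤ using (ℤ; +_; ∣_∣)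
import Data.Integer.Properties as ℤₚ
import Data.Integer.Tactic.RingSolver as ℤ-Solver
open import Data.Nat as ℕ using (ℕ; zero; suc; _∸_; _!; z≤n; s≤s; NonZero)
import Data.Nat.Properties as ℕₚ
open import Data.Empty using (⊥-elim)
open import Data.Nat.Divisibility using (_∣_; _∣?_; divides; 1∣_; ∣-trans; m∣m*n; *-monoˡ-∣; *-cancelˡ-∣; ∣⇒≤; m≤n⇒m!∣n!)
open import Data.Nat.Primality using (Prime; euclidsLemma; prime⇒nonZero; prime⇒nonTrivial)
open import Data.Nat.Combinatorics using (_C_; nCk+nC[k+1]≡[n+1]C[k+1]; k>n⇒nCk≡0)
open import Data.Product using (∃; _×_; _,_)
open import Data.Sum using (inj₁; inj₂)
open import Data.Rational using (ℚ; mkℚ; _+_; _*_; _-_; -_; _/_; 0ℚ; 1ℚ; toℚᵘ; ↥_; ↧_; ↧ₙ_)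
open import Data.Rational.Properties
  using (_≟_; +-*-commutativeRing; toℚᵘ-injective; toℚᵘ-fromℚᵘ; toℚᵘ-homo-+; toℚᵘ-homo-*; toℚᵘ-homo‿-;
         +-identityʳ; +-assoc; *-identityʳ; *-zeroʳ; *-zeroˡ; *-assoc)
open import Data.Rational.Unnormalised using (mkℚᵘ; *≡*; _≃_)
import Data.Rational.Unnormalised.Properties as ℚᵘₚ
open import Level using (0ℓ)
open import Relation.Binary.PropositionalEquality
open import Relation.Nullary using (¬_; yes; no)
open import Relation.Nullary.Decidable using (dec⇒maybe)
open import Tactic.RingSolver using (solve-∀)
open import Tactic.RingSolver.Core.AlmostCommutativeRing using (AlmostCommutativeRing; fromCommutativeRing)

open ≡-Reasoning

ℚ-ring : AlmostCommutativeRing 0ℓ 0ℓ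
ℚ-ring = fromCommutativeRing +-*-commutativeRing (λ q → dec⇒maybe (0ℚ ≟ q))

int : ℤ → ℚ
int z = z / 1

toℚᵘ-/ : ∀ z d → toℚᵘ (z / suc d) ≃ mkℚᵘ z d
toℚᵘ-/ z d = toℚᵘ-fromℚᵘ (mkℚᵘ z d)

int-≡ : ∀ z {q} → mkℚᵘ z 0 ≃ toℚᵘ q → int z ≡ q
int-≡ z eq = toℚᵘ-injective (ℚᵘₚ.≃-trans (toℚᵘ-/ z 0) eq)

int-homo-+ : ∀ a b → int (a ℤ.+ b) ≡ int a + int b
int-homo-+ a b = int-≡ (a ℤ.+ b) (ℚᵘₚ.≃-sym (ℚᵘₚ.≃-trans (toℚᵘ-homo-+ (int a) (int b))
  (ℚᵘₚ.≃-trans (ℚᵘₚ.+-cong (toℚᵘ-/ a 0) (toℚᵘ-/ b 0)) (*≡* (cross a b)))))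
  where
  cross : ∀ a b → (a ℤ.* + 1 ℤ.+ b ℤ.* + 1) ℤ.* + 1 ≡ (a ℤ.+ b) ℤ.* + 1
  cross = ℤ-Solver.solve-∀

int-homo-* : ∀ a b → int (a ℤ.* b) ≡ int a * int b
int-homo-* a b = int-≡ (a ℤ.* b) (ℚᵘₚ.≃-sym (ℚᵘₚ.≃-trans (toℚᵘ-homo-* (int a) (int b))
  (ℚᵘₚ.*-cong (toℚᵘ-/ a 0) (toℚᵘ-/ b 0))))

int-homo‿- : ∀ a → int (ℤ.- a) ≡ - int a
int-homo‿- a = int-≡ (ℤ.- a) (ℚᵘₚ.≃-sym (ℚᵘₚ.≃-trans (toℚᵘ-homo‿- (int a)) (ℚᵘₚ.-‿cong (toℚᵘ-/ a 0))))

nat-homo-+ : ∀ a b → nat (a ℕ.+ b) ≡ nat a + nat b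
nat-homo-+ a b = int-homo-+ (+ a) (+ b)

nat-homo-* : ∀ a b → nat (a ℕ.* b) ≡ nat a * nat b
nat-homo-* a b = trans (cong int (ℤₚ.pos-* a b)) (int-homo-* (+ a) (+ b))

nat-suc : ∀ a → nat (suc a) ≡ nat a + 1ℚ
nat-suc a = trans (cong nat (ℕₚ.+-comm 1 a)) (nat-homo-+ a 1)

nat-inverseˡ : ∀ d .{{_ : NonZero d}} → (+ 1 / d) * nat d ≡ 1ℚ
nat-inverseˡ (suc d) = toℚᵘ-injective (ℚᵘₚ.≃-trans (toℚᵘ-homo-* (+ 1 / suc d) (nat (suc d)))
  (ℚᵘₚ.≃-trans (ℚᵘₚ.*-cong (toℚᵘ-/ (+ 1) d) (toℚᵘ-/ (+ suc d) 0)) (*≡* (cong +_ (ℕₚ.*-assoc 1 (suc d) 1)))))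

nat-pascal : ∀ n k → nat (n C k) + nat (n C suc k) ≡ nat (suc n C suc k)
nat-pascal n k = trans (sym (nat-homo-+ (n C k) (n C suc k))) (cong nat (nCk+nC[k+1]≡[n+1]C[k+1] n k))

*-nat-∸ : ∀ (m : ℚ) {j k} → j ℕ.≤ k → m * nat k - m * nat j ≡ m * nat (k ∸ j)
*-nat-∸ m {j} {k} j≤k = begin
    m * nat k - m * nat j
  ≡⟨ cong (λ i → m * nat i - m * nat j) (ℕₚ.m∸n+n≡m j≤k) ⟨
    m * nat (k ∸ j ℕ.+ j) - m * nat j
  ≡⟨ cong (λ y → m * y - m * nat j) (nat-homo-+ (k ∸ j) j) ⟩
    m * (nat (k ∸ j) + nat j) - m * nat j
  ≡⟨ cancel m (nat (k ∸ j)) (nat j) ⟩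
    m * nat (k ∸ j)
  ∎
  where
  cancel : ∀ m a b → m * (a + b) - m * b ≡ m * a
  cancel = solve-∀ ℚ-ring

sumBelow-cong : ∀ n {f g : ℕ → ℚ} → (∀ x → x ℕ.< n → f x ≡ g x) → sumBelow n f ≡ sumBelow n g
sumBelow-cong zero    f≗g = refl
sumBelow-cong (suc n) f≗g = cong₂ _+_ (sumBelow-cong n (λ x x<n → f≗g x (ℕₚ.m<n⇒m<1+n x<n))) (f≗g n ℕₚ.≤-refl)

sumBelow-+ : ∀ n (f g : ℕ → ℚ) → sumBelow n (λ x → f x + g x) ≡ sumBelow n f + sumBelow n g
sumBelow-+ zero    f g = refl
sumBelow-+ (suc n) f g = trans (cong (_+ (f n + g n)) (sumBelow-+ n f g)) (interchange (sumBelow n f) (sumBelow n g) (f n) (g n))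
  where
  interchange : ∀ a b c d → (a + b) + (c + d) ≡ (a + c) + (b + d)
  interchange = solve-∀ ℚ-ring

sumBelow-- : ∀ n (f g : ℕ → ℚ) → sumBelow n (λ x → f x - g x) ≡ sumBelow n f - sumBelow n g
sumBelow-- zero    f g = refl
sumBelow-- (suc n) f g = trans (cong (_+ (f n - g n)) (sumBelow-- n f g)) (interchange (sumBelow n f) (sumBelow n g) (f n) (g n))
  where
  interchange : ∀ a b c d → (a - b) + (c - d) ≡ (a + c) - (b + d)
  interchange = solve-∀ ℚ-ring

sumBelow-*ˡ : ∀ n (c : ℚ) (f : ℕ → ℚ) → sumBelow n (λ x → c * f x) ≡ c * sumBelow n f
sumBelow-*ˡ zero    c f = annihilate c
  where
  annihilate : ∀ c → 0ℚ ≡ c * 0ℚ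
  annihilate = solve-∀ ℚ-ring
sumBelow-*ˡ (suc n) c f = trans (cong (_+ c * f n) (sumBelow-*ˡ n c f)) (distrib c (sumBelow n f) (f n))
  where
  distrib : ∀ c a b → c * a + c * b ≡ c * (a + b)
  distrib = solve-∀ ℚ-ring

sumBelow-*ʳ : ∀ n (c : ℚ) (f : ℕ → ℚ) → sumBelow n (λ x → f x * c) ≡ sumBelow n f * c
sumBelow-*ʳ zero    c f = annihilate c
  where
  annihilate : ∀ c → 0ℚ ≡ 0ℚ * c
  annihilate = solve-∀ ℚ-ring
sumBelow-*ʳ (suc n) c f = trans (cong (_+ f n * c) (sumBelow-*ʳ n c f)) (distrib c (sumBelow n f) (f n))
  where
  distrib : ∀ c a b → a * c + b * c ≡ (a + b) * c
  distrib = solve-∀ ℚ-ring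

sumBelow-shift : ∀ n (f : ℕ → ℚ) → sumBelow (suc n) f ≡ f 0 + sumBelow n (λ x → f (suc x))
sumBelow-shift zero    f = swap (f 0)
  where
  swap : ∀ a → 0ℚ + a ≡ a + 0ℚ
  swap = solve-∀ ℚ-ring
sumBelow-shift (suc n) f = trans (cong (_+ f (suc n)) (sumBelow-shift n f)) (+-assoc (f 0) _ _)

sumBelow-vanishing : ∀ {n K} (f : ℕ → ℚ) → n ℕ.≤′ K → (∀ x → n ℕ.≤ x → f x ≡ 0ℚ) → sumBelow K f ≡ sumBelow n f
sumBelow-vanishing f ℕ.≤′-refl               vanish = refl
sumBelow-vanishing {n} f (ℕ.≤′-step {K} n≤′K) vanish = begin
    sumBelow K f + f K
  ≡⟨ cong₂ _+_ (sumBelow-vanishing f n≤′K vanish) (vanish K (ℕₚ.≤′⇒≤ n≤′K)) ⟩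
    sumBelow n f + 0ℚ
  ≡⟨ +-identityʳ _ ⟩
    sumBelow n f
  ∎

-- Finite differences

Δ : (ℕ → ℚ) → ℕ → ℚ
Δ f x = f (suc x) - f x

Δ^ : ℕ → (ℕ → ℚ) → ℕ → ℚ
Δ^ zero    f = f
Δ^ (suc k) f = Δ^ k (Δ f)

Δ^-cong : ∀ k {f g : ℕ → ℚ} → (∀ x → f x ≡ g x) → ∀ x → Δ^ k f x ≡ Δ^ k g x
Δ^-cong zero    f≗g = f≗g
Δ^-cong (suc k) f≗g = Δ^-cong k (λ y → cong₂ _-_ (f≗g (suc y)) (f≗g y))

Δ^-*ʳ : ∀ k (c : ℚ) (f : ℕ → ℚ) x → Δ^ k (λ y → f y * c) x ≡ Δ^ k f x * c
Δ^-*ʳ zero    c f x = refl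
Δ^-*ʳ (suc k) c f x = trans (Δ^-cong k (λ y → distrib (f (suc y)) (f y) c) x) (Δ^-*ʳ k c (Δ f) x)
  where
  distrib : ∀ a b c → a * c - b * c ≡ (a - b) * c
  distrib = solve-∀ ℚ-ring

newton : ∀ {x K} (f : ℕ → ℚ) → x ℕ.< K → f x ≡ sumBelow K (λ k → nat (x C k) * Δ^ k f 0)
newton {zero} {suc K} f _ = begin
    f 0
  ≡⟨ pad (f 0) (sumBelow K (λ k → Δ^ (suc k) f 0)) ⟩
    1ℚ * f 0 + 0ℚ * sumBelow K (λ k → Δ^ (suc k) f 0)
  ≡⟨ cong (_+_ (1ℚ * f 0)) (sym (sumBelow-*ˡ K 0ℚ (λ k → Δ^ (suc k) f 0))) ⟩
    1ℚ * f 0 + sumBelow K (λ k → nat (0 C suc k) * Δ^ (suc k) f 0)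
  ≡⟨ sumBelow-shift K _ ⟨
    sumBelow (suc K) (λ k → nat (0 C k) * Δ^ k f 0)
  ∎
  where
  pad : ∀ a b → a ≡ 1ℚ * a + 0ℚ * b
  pad = solve-∀ ℚ-ring
newton {suc x} {suc K} f (s≤s x<K) = begin
    f (suc x)
  ≡⟨ split (f (suc x)) (f x) ⟩
    f x + Δ f x
  ≡⟨ cong₂ _+_ (trans (newton f (ℕₚ.m<n⇒m<1+n x<K)) (sumBelow-shift K _)) (newton (Δ f) x<K) ⟩
    (1ℚ * f 0 + sumBelow K (λ k → nat (x C suc k) * a (suc k))) + sumBelow K (λ k → nat (x C k) * a (suc k))
  ≡⟨ +-assoc (1ℚ * f 0) _ _ ⟩
    1ℚ * f 0 + (sumBelow K (λ k → nat (x C suc k) * a (suc k)) + sumBelow K (λ k → nat (x C k) * a (suc k)))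
  ≡⟨ cong (_+_ (1ℚ * f 0)) (sym (sumBelow-+ K _ _)) ⟩
    1ℚ * f 0 + sumBelow K (λ k → nat (x C suc k) * a (suc k) + nat (x C k) * a (suc k))
  ≡⟨ cong (_+_ (1ℚ * f 0)) (sumBelow-cong K (λ k _ → combine (nat (x C suc k)) (nat (x C k)) (a (suc k)))) ⟩
    1ℚ * f 0 + sumBelow K (λ k → (nat (x C k) + nat (x C suc k)) * a (suc k))
  ≡⟨ cong (_+_ (1ℚ * f 0)) (sumBelow-cong K (λ k _ → cong (_* a (suc k)) (nat-pascal x k))) ⟩
    1ℚ * f 0 + sumBelow K (λ k → nat (suc x C suc k) * a (suc k))
  ≡⟨ sumBelow-shift K _ ⟨
    sumBelow (suc K) (λ k → nat (suc x C k) * a k)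
  ∎
  where
  a : ℕ → ℚ
  a k = Δ^ k f 0
  split : ∀ u v → u ≡ v + (u - v)
  split = solve-∀ ℚ-ring
  combine : ∀ u v w → u * w + v * w ≡ (v + u) * w
  combine = solve-∀ ℚ-ring

sumBelow-newton : ∀ {M K} (f : ℕ → ℚ) → M ℕ.≤ K → sumBelow M f ≡ sumBelow K (λ k → nat (M C suc k) * Δ^ k f 0)
sumBelow-newton {zero}  {K} f _ = sym (trans (sumBelow-*ˡ K 0ℚ (λ k → Δ^ k f 0)) (*-zeroˡ (sumBelow K (λ k → Δ^ k f 0))))
sumBelow-newton {suc M} {K} f M<K = begin
    sumBelow M f + f M
  ≡⟨ cong₂ _+_ (sumBelow-newton f (ℕₚ.<⇒≤ M<K)) (newton f M<K) ⟩
    sumBelow K (λ k → nat (M C suc k) * a k) + sumBelow K (λ k → nat (M C k) * a k)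
  ≡⟨ sumBelow-+ K _ _ ⟨
    sumBelow K (λ k → nat (M C suc k) * a k + nat (M C k) * a k)
  ≡⟨ sumBelow-cong K (λ k _ → combine (nat (M C suc k)) (nat (M C k)) (a k)) ⟩
    sumBelow K (λ k → (nat (M C k) + nat (M C suc k)) * a k)
  ≡⟨ sumBelow-cong K (λ k _ → cong (_* a k) (nat-pascal M k)) ⟩
    sumBelow K (λ k → nat (suc M C suc k) * a k)
  ∎
  where
  a : ℕ → ℚ
  a k = Δ^ k f 0
  combine : ∀ u v w → u * w + v * w ≡ (v + u) * w
  combine = solve-∀ ℚ-ring

alternating-pascal : ∀ k (f : ℕ → ℚ) →
  sumBelow (suc k) (λ j → sgn j * nat (k C j) * f (suc k ∸ j)) - sumBelow (suc k) (λ j → sgn j * nat (k C j) * f (k ∸ j))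
    ≡ sumBelow (suc (suc k)) (λ j → sgn j * nat (suc k C j) * f (suc k ∸ j))
alternating-pascal k f = begin
    sumBelow (suc k) (λ j → g j * f (suc k ∸ j)) - E
  ≡⟨ cong (_- E) (sumBelow-shift k _) ⟩
    (1ℚ * 1ℚ * f (suc k) + sumBelow k h) - E
  ≡⟨ cong (λ s → (1ℚ * 1ℚ * f (suc k) + s) - E) extend ⟩
    (1ℚ * 1ℚ * f (suc k) + sumBelow (suc k) h) - E
  ≡⟨ regroup (1ℚ * 1ℚ * f (suc k)) (sumBelow (suc k) h) E ⟩
    1ℚ * 1ℚ * f (suc k) + (sumBelow (suc k) h - E)
  ≡⟨ cong (_+_ (1ℚ * 1ℚ * f (suc k))) (sumBelow-- (suc k) h _) ⟨
    1ℚ * 1ℚ * f (suc k) + sumBelow (suc k) (λ j → h j - g j * f (k ∸ j))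
  ≡⟨ cong (_+_ (1ℚ * 1ℚ * f (suc k))) (sumBelow-cong (suc k) (λ j _ → pascal j)) ⟩
    1ℚ * 1ℚ * f (suc k) + sumBelow (suc k) (λ j → sgn (suc j) * nat (suc k C suc j) * f (k ∸ j))
  ≡⟨ sumBelow-shift (suc k) _ ⟨
    sumBelow (suc (suc k)) (λ j → sgn j * nat (suc k C j) * f (suc k ∸ j))
  ∎
  where
  g : ℕ → ℚ
  g j = sgn j * nat (k C j)
  h : ℕ → ℚ
  h j = g (suc j) * f (k ∸ j)
  E : ℚ
  E = sumBelow (suc k) (λ j → g j * f (k ∸ j))
  extend : sumBelow k h ≡ sumBelow (suc k) h
  extend = sym (trans (cong (λ c → sumBelow k h + sgn (suc k) * nat c * f (k ∸ k)) (k>n⇒nCk≡0 (ℕₚ.n<1+n k)))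
                      (drop-zero (sumBelow k h) (sgn (suc k)) (f (k ∸ k))))
    where
    drop-zero : ∀ a s y → a + s * 0ℚ * y ≡ a
    drop-zero = solve-∀ ℚ-ring
  regroup : ∀ a b c → (a + b) - c ≡ a + (b - c)
  regroup = solve-∀ ℚ-ring
  pascal : ∀ j → h j - g j * f (k ∸ j) ≡ sgn (suc j) * nat (suc k C suc j) * f (k ∸ j)
  pascal j = trans (combine (sgn j) (nat (k C j)) (nat (k C suc j)) (f (k ∸ j)))
                   (cong (λ c → - sgn j * c * f (k ∸ j)) (nat-pascal k j))
    where
    combine : ∀ s a b y → - s * b * y - s * a * y ≡ - s * (a + b) * y
    combine = solve-∀ ℚ-ring

Δ^-explicit : ∀ k (f : ℕ → ℚ) → Δ^ k f 0 ≡ sumBelow (suc k) (λ j → sgn j * nat (k C j) * f (k ∸ j))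
Δ^-explicit zero    f = pad (f 0)
  where
  pad : ∀ a → a ≡ 0ℚ + 1ℚ * 1ℚ * a
  pad = solve-∀ ℚ-ring
Δ^-explicit (suc k) f = begin
    Δ^ k (Δ f) 0
  ≡⟨ Δ^-explicit k (Δ f) ⟩
    sumBelow (suc k) (λ j → g j * (f (suc (k ∸ j)) - f (k ∸ j)))
  ≡⟨ sumBelow-cong (suc k) distribute ⟩
    sumBelow (suc k) (λ j → g j * f (suc k ∸ j) - g j * f (k ∸ j))
  ≡⟨ sumBelow-- (suc k) _ _ ⟩
    sumBelow (suc k) (λ j → g j * f (suc k ∸ j)) - sumBelow (suc k) (λ j → g j * f (k ∸ j))
  ≡⟨ alternating-pascal k f ⟩
    sumBelow (suc (suc k)) (λ j → sgn j * nat (suc k C j) * f (suc k ∸ j))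
  ∎
  where
  g : ℕ → ℚ
  g j = sgn j * nat (k C j)
  distrib : ∀ c a b → c * (a - b) ≡ c * a - c * b
  distrib = solve-∀ ℚ-ring
  distribute : ∀ j → j ℕ.< suc k → g j * (f (suc (k ∸ j)) - f (k ∸ j)) ≡ g j * f (suc k ∸ j) - g j * f (k ∸ j)
  distribute j (s≤s j≤k) = trans (cong (λ i → g j * (f i - f (k ∸ j))) (sym (ℕₚ.+-∸-assoc 1 j≤k))) (distrib (g j) _ _)

-- Polynomial functions

DegreeAtMost : ℕ → (ℕ → ℚ) → Set
DegreeAtMost zero    f = ∀ x → f x ≡ f 0
DegreeAtMost (suc d) f = DegreeAtMost d (Δ f)

degree-cong : ∀ d {f g : ℕ → ℚ} → (∀ x → f x ≡ g x) → DegreeAtMost d f → DegreeAtMost d g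
degree-cong zero    f≗g deg x = trans (sym (f≗g x)) (trans (deg x) (f≗g 0))
degree-cong (suc d) f≗g deg   = degree-cong d (λ y → cong₂ _-_ (f≗g (suc y)) (f≗g y)) deg

degree-+ : ∀ d {f g : ℕ → ℚ} → DegreeAtMost d f → DegreeAtMost d g → DegreeAtMost d (λ x → f x + g x)
degree-+ zero    degf degg x = cong₂ _+_ (degf x) (degg x)
degree-+ (suc d) {f} {g} degf degg =
  degree-cong d (λ y → interchange (f (suc y)) (g (suc y)) (f y) (g y)) (degree-+ d degf degg)
  where
  interchange : ∀ a b c d → (a - c) + (b - d) ≡ (a + b) - (c + d)
  interchange = solve-∀ ℚ-ring

degree-*ʳ : ∀ d (c : ℚ) {f : ℕ → ℚ} → DegreeAtMost d f → DegreeAtMost d (λ x → f x * c)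
degree-*ʳ zero    c deg x = cong (_* c) (deg x)
degree-*ʳ (suc d) c {f} deg = degree-cong d (λ y → distrib (f (suc y)) (f y) c) (degree-*ʳ d c deg)
  where
  distrib : ∀ a b c → (a - b) * c ≡ a * c - b * c
  distrib = solve-∀ ℚ-ring

constant⇒Δ≡0 : ∀ {f : ℕ → ℚ} → DegreeAtMost 0 f → ∀ x → Δ f x ≡ 0ℚ
constant⇒Δ≡0 {f} deg x = trans (cong₂ _-_ (deg (suc x)) (deg x)) (cancel (f 0))
  where
  cancel : ∀ a → a - a ≡ 0ℚ
  cancel = solve-∀ ℚ-ring

Δ-*-linear : ∀ (f : ℕ → ℚ) a b y →
  Δ (λ x → f x * (a * nat x + b)) y ≡ Δ f y * (a * nat y + (a + b)) + f y * a
Δ-*-linear f a b y = trans (cong (λ n → f (suc y) * (a * n + b) - f y * (a * nat y + b)) (nat-suc y))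
                           (leibniz (f (suc y)) (f y) a (nat y) b)
  where
  leibniz : ∀ u v a n b → u * (a * (n + 1ℚ) + b) - v * (a * n + b) ≡ (u - v) * (a * n + (a + b)) + v * a
  leibniz = solve-∀ ℚ-ring

degree-*-linear : ∀ d {f : ℕ → ℚ} a b → DegreeAtMost d f → DegreeAtMost (suc d) (λ x → f x * (a * nat x + b))
degree-*-linear d {f} a b deg = degree-cong d (λ y → sym (Δ-*-linear f a b y)) (step d deg)
  where
  step : ∀ d {f : ℕ → ℚ} {b} → DegreeAtMost d f → DegreeAtMost d (λ y → Δ f y * (a * nat y + (a + b)) + f y * a)
  step zero    {f} {b} deg y = trans (flat y) (sym (flat 0))
    where
    drop-zero : ∀ u w → 0ℚ * u + w ≡ w
    drop-zero = solve-∀ ℚ-ring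
    flat : ∀ y → Δ f y * (a * nat y + (a + b)) + f y * a ≡ f 0 * a
    flat y = trans (cong₂ (λ u v → u * (a * nat y + (a + b)) + v * a) (constant⇒Δ≡0 deg y) (deg y))
                   (drop-zero (a * nat y + (a + b)) (f 0 * a))
  step (suc d) {f} {b} deg = degree-+ (suc d) {λ y → Δ f y * (a * nat y + (a + b))} {λ y → f y * a}
    (degree-*-linear d a (a + b) deg) (degree-*ʳ (suc d) a {f} deg)

Δ^-const-0 : ∀ k x → Δ^ k (λ _ → 0ℚ) x ≡ 0ℚ
Δ^-const-0 zero    x = refl
Δ^-const-0 (suc k) x = Δ^-const-0 k x

degree-Δ^-vanishes : ∀ d {f : ℕ → ℚ} → DegreeAtMost d f → ∀ k → d ℕ.< k → Δ^ k f 0 ≡ 0ℚ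
degree-Δ^-vanishes zero    deg (suc k) _         = trans (Δ^-cong k (constant⇒Δ≡0 deg) 0) (Δ^-const-0 k 0)
degree-Δ^-vanishes (suc d) deg (suc k) (s≤s d<k) = degree-Δ^-vanishes d deg k d<k

falling-degree : ∀ n (m : ℚ) → DegreeAtMost n (λ x → falling (m * nat x) n)
falling-degree zero    m x = refl
falling-degree (suc n) m   = degree-*-linear n m (- nat n) (falling-degree n m)

binom-degree : ∀ n (m : ℚ) → DegreeAtMost n (λ x → binom (m * nat x) n)
binom-degree n m = degree-*ʳ n _ (falling-degree n m)

-- Integrality

IsInteger : ℚ → Set
IsInteger q = ∃ λ z → q ≡ int z

isInteger-nat : ∀ n → IsInteger (nat n)
isInteger-nat n = + n , refl

isInteger-+ : ∀ {a b} → IsInteger a → IsInteger b → IsInteger (a + b)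
isInteger-+ (za , refl) (zb , refl) = za ℤ.+ zb , sym (int-homo-+ za zb)

isInteger-* : ∀ {a b} → IsInteger a → IsInteger b → IsInteger (a * b)
isInteger-* (za , refl) (zb , refl) = za ℤ.* zb , sym (int-homo-* za zb)

isInteger-neg : ∀ {a} → IsInteger a → IsInteger (- a)
isInteger-neg (za , refl) = ℤ.- za , sym (int-homo‿- za)

isInteger-- : ∀ {a b} → IsInteger a → IsInteger b → IsInteger (a - b)
isInteger-- ia ib = isInteger-+ ia (isInteger-neg ib)

isInteger-sgn : ∀ k → IsInteger (sgn k)
isInteger-sgn zero    = isInteger-nat 1
isInteger-sgn (suc k) = isInteger-neg (isInteger-sgn k)

isInteger-*-denominator : ∀ m → IsInteger (m * nat (↧ₙ m))
isInteger-*-denominator m@(mkℚ n d _) = n , sym (int-≡ n (ℚᵘₚ.≃-sym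
  (ℚᵘₚ.≃-trans (toℚᵘ-homo-* m (nat (suc d)))
    (ℚᵘₚ.≃-trans (ℚᵘₚ.*-cong (ℚᵘₚ.≃-refl {mkℚᵘ n d}) (toℚᵘ-/ (+ suc d) 0))
      (*≡* (trans (ℤₚ.*-identityʳ _) (cong (λ e → n ℤ.* + e) (sym (ℕₚ.*-identityʳ (suc d))))))))))

Δ^-isInteger : ∀ {g : ℕ → ℚ} → (∀ x → IsInteger (g x)) → ∀ k x → IsInteger (Δ^ k g x)
Δ^-isInteger ig zero    x = ig x
Δ^-isInteger ig (suc k) x = Δ^-isInteger (λ y → isInteger-- (ig (suc y)) (ig y)) k x

IsMultipleOf : ℕ → ℚ → Set
IsMultipleOf M q = ∃ λ w → IsInteger w × q ≡ nat M * w

isMultipleOf-*ʳ : ∀ {M q r} → IsMultipleOf M q → IsInteger r → IsMultipleOf M (q * r)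
isMultipleOf-*ʳ {M} {r = r} (w , iw , refl) ir = w * r , isInteger-* iw ir , *-assoc (nat M) w r

isMultipleOf-sumBelow : ∀ M n (g : ℕ → ℚ) → (∀ x → x ℕ.< n → IsMultipleOf M (g x)) → IsMultipleOf M (sumBelow n g)
isMultipleOf-sumBelow M zero    g mult = 0ℚ , isInteger-nat 0 , annihilate (nat M)
  where
  annihilate : ∀ y → 0ℚ ≡ y * 0ℚ
  annihilate = solve-∀ ℚ-ring
isMultipleOf-sumBelow M (suc n) g mult
  with isMultipleOf-sumBelow M n g (λ x x<n → mult x (ℕₚ.m<n⇒m<1+n x<n)) | mult n ℕₚ.≤-refl
... | w₁ , i₁ , e₁ | w₂ , i₂ , e₂ = w₁ + w₂ , isInteger-+ i₁ i₂ , trans (cong₂ _+_ e₁ e₂) (distrib (nat M) w₁ w₂)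
  where
  distrib : ∀ y a b → y * a + y * b ≡ y * (a + b)
  distrib = solve-∀ ℚ-ring

falling-zero : ∀ j → falling 0ℚ (suc j) ≡ 0ℚ
falling-zero zero    = refl
falling-zero (suc j) = trans (cong (_* (0ℚ - nat (suc j))) (falling-zero j)) (*-zeroˡ (0ℚ - nat (suc j)))

falling-+1 : ∀ y k → falling (y + 1ℚ) (suc k) ≡ (y + 1ℚ) * falling y k
falling-+1 y zero    = base y
  where
  base : ∀ y → 1ℚ * (y + 1ℚ - 0ℚ) ≡ (y + 1ℚ) * 1ℚ
  base = solve-∀ ℚ-ring
falling-+1 y (suc k) = trans (cong₂ (λ u v → u * (y + 1ℚ - v)) (falling-+1 y k) (nat-suc k))
                             (shift y (falling y k) (nat k))
  where
  shift : ∀ y f n → (y + 1ℚ) * f * (y + 1ℚ - (n + 1ℚ)) ≡ (y + 1ℚ) * (f * (y - n))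
  shift = solve-∀ ℚ-ring

falling-nat-suc : ∀ M k → falling (nat (suc M)) (suc k) ≡ nat (suc M) * falling (nat M) k
falling-nat-suc M k = begin
    falling (nat (suc M)) (suc k)
  ≡⟨ cong (λ y → falling y (suc k)) (nat-suc M) ⟩
    falling (nat M + 1ℚ) (suc k)
  ≡⟨ falling-+1 (nat M) k ⟩
    (nat M + 1ℚ) * falling (nat M) k
  ≡⟨ cong (_* falling (nat M) k) (nat-suc M) ⟨
    nat (suc M) * falling (nat M) k
  ∎

nat-C*!≡falling : ∀ x j → nat (x C j) * nat (j !) ≡ falling (nat x) j
nat-C*!≡falling zero    zero    = refl
nat-C*!≡falling zero    (suc j) = trans (*-zeroˡ (nat (suc j !))) (sym (falling-zero j))
nat-C*!≡falling (suc x) zero    = refl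
nat-C*!≡falling (suc x) (suc j) = begin
    nat (suc x C suc j) * nat (suc j ℕ.* j !)
  ≡⟨ cong₂ _*_ (sym (nat-pascal x j)) (nat-homo-* (suc j) (j !)) ⟩
    (A + B) * (S * F)
  ≡⟨ expand A B S F ⟩
    S * (A * F) + B * (S * F)
  ≡⟨ cong₂ (λ u v → S * u + B * v) (nat-C*!≡falling x j) (sym (nat-homo-* (suc j) (j !))) ⟩
    S * falling (nat x) j + B * nat (suc j !)
  ≡⟨ cong₂ (λ u v → u * falling (nat x) j + v) (nat-suc j) (nat-C*!≡falling x (suc j)) ⟩
    (nat j + 1ℚ) * falling (nat x) j + falling (nat x) j * (nat x - nat j)
  ≡⟨ collect (nat j) (falling (nat x) j) (nat x) ⟩
    (nat x + 1ℚ) * falling (nat x) j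
  ≡⟨ cong (_* falling (nat x) j) (nat-suc x) ⟨
    nat (suc x) * falling (nat x) j
  ≡⟨ falling-nat-suc x j ⟨
    falling (nat (suc x)) (suc j)
  ∎
  where
  A = nat (x C j)
  B = nat (x C suc j)
  S = nat (suc j)
  F = nat (j !)
  expand : ∀ A B S F → (A + B) * (S * F) ≡ S * (A * F) + B * (S * F)
  expand = solve-∀ ℚ-ring
  collect : ∀ J f X → (J + 1ℚ) * f + f * (X - J) ≡ (X + 1ℚ) * f
  collect = solve-∀ ℚ-ring

falling-≡-sgn*!-mod : ∀ M k → IsMultipleOf (suc M) (falling (nat M) k - sgn k * nat (k !))
falling-≡-sgn*!-mod M zero    = 0ℚ , isInteger-nat 0 , cancel (nat (suc M))
  where
  cancel : ∀ y → 1ℚ - 1ℚ * 1ℚ ≡ y * 0ℚ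
  cancel = solve-∀ ℚ-ring
falling-≡-sgn*!-mod M (suc k) with falling-≡-sgn*!-mod M k
... | w , iw , eq = w * (Y - N) + s * F ,
  isInteger-+ (isInteger-* iw (isInteger-- (isInteger-nat (suc M)) (isInteger-nat (suc k))))
              (isInteger-* (isInteger-sgn k) (isInteger-nat (k !))) ,
  (begin
    G * (nat M - nat k) - (- s) * nat (suc k ℕ.* k !)
  ≡⟨ cong₂ (λ u v → G * u - (- s) * v) (shift (nat M) (nat k)) (nat-homo-* (suc k) (k !)) ⟩
    G * ((nat M + 1ℚ) - (nat k + 1ℚ)) - (- s) * (N * F)
  ≡⟨ cong₂ (λ u v → G * (u - v) - (- s) * (N * F)) (nat-suc M) (nat-suc k) ⟨
    G * (Y - N) - (- s) * (N * F)
  ≡⟨ cong (λ u → u * (Y - N) - (- s) * (N * F)) (trans (split G (s * F)) (cong (_+ s * F) eq)) ⟩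
    (Y * w + s * F) * (Y - N) - (- s) * (N * F)
  ≡⟨ factor Y w s F N ⟩
    Y * (w * (Y - N) + s * F)
  ∎)
  where
  G = falling (nat M) k
  Y = nat (suc M)
  N = nat (suc k)
  s = sgn k
  F = nat (k !)
  shift : ∀ a b → a - b ≡ (a + 1ℚ) - (b + 1ℚ)
  shift = solve-∀ ℚ-ring
  split : ∀ a b → a ≡ (a - b) + b
  split = solve-∀ ℚ-ring
  factor : ∀ Y w s F N → (Y * w + s * F) * (Y - N) - (- s) * (N * F) ≡ Y * (w * (Y - N) + s * F)
  factor = solve-∀ ℚ-ring

falling-*-denominator^n : ∀ (m : ℚ) x n → IsInteger (falling (m * nat x) n * nat (↧ₙ m ℕ.^ n))
falling-*-denominator^n m x zero    = isInteger-nat 1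
falling-*-denominator^n m x (suc n) = subst IsInteger (sym eq)
  (isInteger-* (falling-*-denominator^n m x n)
    (isInteger-- (isInteger-* (isInteger-*-denominator m) (isInteger-nat x))
                 (isInteger-* (isInteger-nat n) (isInteger-nat (↧ₙ m)))))
  where
  v = ↧ₙ m
  regroup : ∀ F m X N V W → F * (m * X - N) * (V * W) ≡ (F * W) * ((m * V) * X - N * V)
  regroup = solve-∀ ℚ-ring
  eq : falling (m * nat x) (suc n) * nat (v ℕ.^ suc n)
     ≡ (falling (m * nat x) n * nat (v ℕ.^ n)) * ((m * nat v) * nat x - nat n * nat v)
  eq = trans (cong (falling (m * nat x) (suc n) *_) (nat-homo-* v (v ℕ.^ n)))
             (regroup (falling (m * nat x) n) m (nat x) (nat n) (nat v) (nat (v ℕ.^ n)))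

binom-*-denominator^n*n! : ∀ (m : ℚ) n x → IsInteger (binom (m * nat x) n * nat (↧ₙ m ℕ.^ n ℕ.* n !))
binom-*-denominator^n*n! m n x = subst IsInteger (sym eq) (falling-*-denominator^n m x n)
  where
  V = ↧ₙ m ℕ.^ n
  instance _ = ℕₚ._!≢0 n
  regroup : ∀ f c V F → (f * c) * (V * F) ≡ (f * V) * (c * F)
  regroup = solve-∀ ℚ-ring
  eq : binom (m * nat x) n * nat (V ℕ.* n !) ≡ falling (m * nat x) n * nat V
  eq = begin
      binom (m * nat x) n * nat (V ℕ.* n !)
    ≡⟨ cong (binom (m * nat x) n *_) (nat-homo-* V (n !)) ⟩
      (falling (m * nat x) n * (+ 1 / n !)) * (nat V * nat (n !))
    ≡⟨ regroup (falling (m * nat x) n) (+ 1 / n !) (nat V) (nat (n !)) ⟩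
      (falling (m * nat x) n * nat V) * ((+ 1 / n !) * nat (n !))
    ≡⟨ cong (falling (m * nat x) n * nat V *_) (nat-inverseˡ (n !)) ⟩
      (falling (m * nat x) n * nat V) * 1ℚ
    ≡⟨ *-identityʳ _ ⟩
      falling (m * nat x) n * nat V
    ∎

-- Riemann sums of polynomials

-- M⁻¹ C(M, k+1) is the Riemann sum M⁻¹ Σ_{x<M} binom(x, k); (−1)ᵏ/(k+1) is its limit.
riemannError : (M : ℕ) .{{_ : NonZero M}} → ℕ → ℚ
riemannError M k = (+ 1 / M) * nat (M C suc k) - sgn k * (+ 1 / suc k)

riemannError-*-! : ∀ M .{{_ : NonZero M}} k → IsMultipleOf M (riemannError M k * nat (suc k !))
riemannError-*-! (suc M) k with falling-≡-sgn*!-mod M k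
... | w , iw , eq = w , iw , (begin
    (iM * B - s * ic) * nat (suc k !)
  ≡⟨ distrib iM B s ic (nat (suc k !)) ⟩
    iM * (B * nat (suc k !)) - s * (ic * nat (suc k ℕ.* k !))
  ≡⟨ cong₂ (λ u v → iM * u - s * (ic * v)) (trans (nat-C*!≡falling (suc M) (suc k)) (falling-nat-suc M k))
                                            (nat-homo-* (suc k) (k !)) ⟩
    iM * (Y * G) - s * (ic * (N * F))
  ≡⟨ regroup iM Y G s ic N F ⟩
    (iM * Y) * G - s * (ic * N) * F
  ≡⟨ cong₂ (λ u v → u * G - s * v * F) (nat-inverseˡ (suc M)) (nat-inverseˡ (suc k)) ⟩
    1ℚ * G - s * 1ℚ * F
  ≡⟨ unit G s F ⟩
    G - s * F
  ≡⟨ eq ⟩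
    Y * w
  ∎)
  where
  iM = + 1 / suc M
  B  = nat (suc M C suc k)
  s  = sgn k
  ic = + 1 / suc k
  Y  = nat (suc M)
  G  = falling (nat M) k
  N  = nat (suc k)
  F  = nat (k !)
  distrib : ∀ iM B s ic P → (iM * B - s * ic) * P ≡ iM * (B * P) - s * (ic * P)
  distrib = solve-∀ ℚ-ring
  regroup : ∀ iM Y G s ic N F → iM * (Y * G) - s * (ic * (N * F)) ≡ (iM * Y) * G - s * (ic * N) * F
  regroup = solve-∀ ℚ-ring
  unit : ∀ G s F → 1ℚ * G - s * 1ℚ * F ≡ G - s * F
  unit = solve-∀ ℚ-ring

riemannSum-error : ∀ M .{{_ : NonZero M}} n (f : ℕ → ℚ) → DegreeAtMost n f →
  (+ 1 / M) * sumBelow M f - sumBelow (suc n) (λ k → (sgn k * (+ 1 / suc k)) * Δ^ k f 0)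
    ≡ sumBelow (suc n) (λ k → riemannError M k * Δ^ k f 0)
riemannSum-error M n f deg = begin
    iM * sumBelow M f - L
  ≡⟨ cong (λ s → iM * s - L) (sumBelow-newton f (ℕₚ.m≤m+n M (suc n))) ⟩
    iM * sumBelow (M ℕ.+ suc n) h - L
  ≡⟨ cong (λ s → iM * s - L) (sumBelow-vanishing h (ℕₚ.≤⇒≤′ (ℕₚ.m≤n+m (suc n) M)) h-vanishes) ⟩
    iM * sumBelow (suc n) h - L
  ≡⟨ cong (_- L) (sumBelow-*ˡ (suc n) iM h) ⟨
    sumBelow (suc n) (λ k → iM * h k) - L
  ≡⟨ sumBelow-- (suc n) _ _ ⟨
    sumBelow (suc n) (λ k → iM * h k - (sgn k * (+ 1 / suc k)) * a k)
  ≡⟨ sumBelow-cong (suc n) (λ k _ → factor iM (nat (M C suc k)) (a k) (sgn k) (+ 1 / suc k)) ⟩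
    sumBelow (suc n) (λ k → riemannError M k * a k)
  ∎
  where
  iM = + 1 / M
  L = sumBelow (suc n) (λ k → (sgn k * (+ 1 / suc k)) * Δ^ k f 0)
  a : ℕ → ℚ
  a k = Δ^ k f 0
  h : ℕ → ℚ
  h k = nat (M C suc k) * a k
  h-vanishes : ∀ k → suc n ℕ.≤ k → h k ≡ 0ℚ
  h-vanishes k n<k = trans (cong (nat (M C suc k) *_) (degree-Δ^-vanishes n deg k n<k)) (*-zeroʳ (nat (M C suc k)))
  factor : ∀ iM B a s ic → iM * (B * a) - (s * ic) * a ≡ (iM * B - s * ic) * a
  factor = solve-∀ ℚ-ring

riemannSum-error-*-! : ∀ M .{{_ : NonZero M}} n (f : ℕ → ℚ) D → (∀ x → IsInteger (f x * nat D)) →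
  IsMultipleOf M (sumBelow (suc n) (λ k → riemannError M k * Δ^ k f 0) * nat (suc n ! ℕ.* D))
riemannSum-error-*-! M n f D integral =
  subst (IsMultipleOf M) (sumBelow-*ʳ (suc n) (nat (suc n ! ℕ.* D)) _)
    (isMultipleOf-sumBelow M (suc n) _ term)
  where
  term : ∀ k → k ℕ.< suc n → IsMultipleOf M ((riemannError M k * Δ^ k f 0) * nat (suc n ! ℕ.* D))
  term k (s≤s k≤n) with m≤n⇒m!∣n! (s≤s k≤n)
  ... | divides r eq = subst (IsMultipleOf M) (sym rearrange)
    (isMultipleOf-*ʳ {M} (riemannError-*-! M k)
      (isInteger-* (isInteger-nat r) (subst IsInteger (Δ^-*ʳ k (nat D) f 0) (Δ^-isInteger integral k 0))))
    where
    regroup : ∀ e a R F D → (e * a) * ((R * F) * D) ≡ (e * F) * (R * (a * D))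
    regroup = solve-∀ ℚ-ring
    rearrange : (riemannError M k * Δ^ k f 0) * nat (suc n ! ℕ.* D)
              ≡ (riemannError M k * nat (suc k !)) * (nat r * (Δ^ k f 0 * nat D))
    rearrange = trans (cong (λ c → (riemannError M k * Δ^ k f 0) * c)
                            (trans (cong (λ c → nat (c ℕ.* D)) eq)
                                   (trans (nat-homo-* (r ℕ.* suc k !) D) (cong (_* nat D) (nat-homo-* r (suc k !))))))
                      (regroup (riemannError M k) (Δ^ k f 0) (nat r) (nat (suc k !)) (nat D))

-- p-adic convergence

cross-multiply : ∀ q c M z → q * nat c ≡ nat M * int z → ↥ q ℤ.* + c ≡ (+ M ℤ.* z) ℤ.* ↧ q
cross-multiply q@(mkℚ n d _) c M z eq
  with ℚᵘₚ.≃-trans (ℚᵘₚ.≃-sym (ℚᵘₚ.*-cong (ℚᵘₚ.≃-refl {mkℚᵘ n d}) (toℚᵘ-/ (+ c) 0)))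
         (ℚᵘₚ.≃-trans (ℚᵘₚ.≃-sym (toℚᵘ-homo-* q (nat c)))
           (ℚᵘₚ.≃-trans (ℚᵘₚ.≃-reflexive (cong toℚᵘ eq))
             (ℚᵘₚ.≃-trans (toℚᵘ-homo-* (nat M) (int z)) (ℚᵘₚ.*-cong (toℚᵘ-/ (+ M) 0) (toℚᵘ-/ z 0)))))
... | *≡* cross = trans (sym (ℤₚ.*-identityʳ (n ℤ.* + c)))
                        (trans cross (cong (λ e → (+ M ℤ.* z) ℤ.* + e) (ℕₚ.*-identityʳ (suc d))))

numerator-divisible : ∀ {M} q c → IsMultipleOf M (q * nat c) → M ∣ ∣ ↥ q ∣ ℕ.* c
numerator-divisible {M} q c (w , (z , refl) , eq) = divides (∣ z ∣ ℕ.* ↧ₙ q) (begin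
    ∣ ↥ q ∣ ℕ.* c
  ≡⟨ ℤₚ.abs-* (↥ q) (+ c) ⟨
    ∣ ↥ q ℤ.* + c ∣
  ≡⟨ cong ∣_∣ (cross-multiply q c M z eq) ⟩
    ∣ (+ M ℤ.* z) ℤ.* ↧ q ∣
  ≡⟨ ℤₚ.abs-* (+ M ℤ.* z) (↧ q) ⟩
    ∣ + M ℤ.* z ∣ ℕ.* ↧ₙ q
  ≡⟨ cong (ℕ._* ↧ₙ q) (ℤₚ.abs-* (+ M) z) ⟩
    M ℕ.* ∣ z ∣ ℕ.* ↧ₙ q
  ≡⟨ ℕₚ.*-assoc M ∣ z ∣ (↧ₙ q) ⟩
    M ℕ.* (∣ z ∣ ℕ.* ↧ₙ q)
  ≡⟨ ℕₚ.*-comm M _ ⟩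
    ∣ z ∣ ℕ.* ↧ₙ q ℕ.* M
  ∎)

module _ {p : ℕ} (pp : Prime p) where

  private instance
    p≢0 = prime⇒nonZero pp

  n<p^n : ∀ n → n ℕ.< p ℕ.^ n
  n<p^n zero    = s≤s z≤n
  n<p^n (suc n) = ℕₚ.≤-<-trans (n<p^n n)
    (ℕₚ.^-monoʳ-< p (ℕ.nonTrivial⇒n>1 p {{prime⇒nonTrivial pp}}) (ℕₚ.n<1+n n))

  p∤a⇒p^k∣a*b⇒p^k∣b : ∀ k {a b} → ¬ p ∣ a → p ℕ.^ k ∣ a ℕ.* b → p ℕ.^ k ∣ b
  p∤a⇒p^k∣a*b⇒p^k∣b zero    {b = b} _ _ = 1∣ b
  p∤a⇒p^k∣a*b⇒p^k∣b (suc k) {a} {b} p∤a p^k∣ab with euclidsLemma a b pp (∣-trans (m∣m*n (p ℕ.^ k)) p^k∣ab)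
  ... | inj₁ p∣a = ⊥-elim (p∤a p∣a)
  ... | inj₂ (divides c refl) = subst (_∣ c ℕ.* p) (ℕₚ.*-comm (p ℕ.^ k) p)
    (*-monoˡ-∣ p (p∤a⇒p^k∣a*b⇒p^k∣b k {a} {c} p∤a (*-cancelˡ-∣ p (subst (p ℕ.* p ℕ.^ k ∣_) reassoc p^k∣ab))))
    where
    reassoc : a ℕ.* (c ℕ.* p) ≡ p ℕ.* (a ℕ.* c)
    reassoc = trans (sym (ℕₚ.*-assoc a c p)) (ℕₚ.*-comm (a ℕ.* c) p)

  -- If p ∤ a then all of p^N would divide c, impossible since c < N < p^N.
  p^N∣a*c⇒p^t∣a : ∀ t {a c N} .{{_ : NonZero c}} → t ℕ.+ c ℕ.≤ N → p ℕ.^ N ∣ a ℕ.* c → p ℕ.^ t ∣ a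
  p^N∣a*c⇒p^t∣a zero    {a} _ _ = 1∣ a
  p^N∣a*c⇒p^t∣a (suc t) {a} {c} {suc N} (s≤s t+c≤N) p^N∣ac with p ∣? a
  ... | no p∤a = ⊥-elim (ℕₚ.<⇒≱ c<p^N (∣⇒≤ (p∤a⇒p^k∣a*b⇒p^k∣b (suc N) p∤a p^N∣ac)))
    where
    c<p^N : c ℕ.< p ℕ.^ suc N
    c<p^N = ℕₚ.<-trans (s≤s (ℕₚ.≤-trans (ℕₚ.m≤n+m c t) t+c≤N)) (n<p^n (suc N))
  ... | yes (divides q refl) = subst (_∣ q ℕ.* p) (ℕₚ.*-comm (p ℕ.^ t) p)
    (*-monoˡ-∣ p (p^N∣a*c⇒p^t∣a t {q} {c} t+c≤N (*-cancelˡ-∣ p (subst (p ℕ.* p ℕ.^ N ∣_) reassoc p^N∣ac))))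
    where
    reassoc : q ℕ.* p ℕ.* c ≡ p ℕ.* (q ℕ.* c)
    reassoc = trans (cong (ℕ._* c) (ℕₚ.*-comm q p)) (ℕₚ.*-assoc p q c)

  padicLimit-of-multiples : ∀ {a : ℕ → ℚ} {L} c .{{_ : NonZero c}} →
    (∀ N → IsMultipleOf (p ℕ.^ N) ((a N - L) * nat c)) → PAdicLimit p a L
  padicLimit-of-multiples {a} {L} c mult t = t ℕ.+ c , λ N t+c≤N → p^N∣a*c⇒p^t∣a t t+c≤N (numerator-divisible (a N - L) c (mult N))

volkenbornIntegral-polynomial : ∀ p (pp : Prime p) n (f : ℕ → ℚ) D .{{_ : NonZero D}} →
  DegreeAtMost n f → (∀ x → IsInteger (f x * nat D)) →
  VolkenbornIntegral p pp f (sumBelow (suc n) (λ k → (sgn k * (+ 1 / suc k)) * Δ^ k f 0))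
volkenbornIntegral-polynomial p pp n f D deg integral =
  padicLimit-of-multiples pp {volkenbornSum p pp f} (suc n ! ℕ.* D) {{ℕₚ.m*n≢0 (suc n !) D {{ℕₚ._!≢0 (suc n)}}}} λ N →
    let instance _ = ℕₚ.m^n≢0 p N in
    subst (λ e → IsMultipleOf (p ℕ.^ N) (e * nat (suc n ! ℕ.* D))) (sym (riemannSum-error (p ℕ.^ N) n f deg))
      (riemannSum-error-*-! (p ℕ.^ N) n f D integral)
  where instance _ = prime⇒nonZero pp

mainTheorem12 : (p : ℕ) (pp : Prime p) (m : ℚ) (n : ℕ) →
    VolkenbornIntegral p pp (λ x → binom (m * nat x) n)
      (sumBelow (suc n) (λ k →
        (sgn k * ((+ 1) / suc k)) *
          sumBelow (suc k) (λ j →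
            sgn j * nat (k C j) * binom (m * nat k - m * nat j) n)))
mainTheorem12 p pp m n =
  subst (VolkenbornIntegral p pp f) (sumBelow-cong (suc n) λ k _ → cong (sgn k * (+ 1 / suc k) *_) (Δ^-binom k))
    (volkenbornIntegral-polynomial p pp n f D (binom-degree n m) (binom-*-denominator^n*n! m n))
  where
  f : ℕ → ℚ
  f x = binom (m * nat x) n
  D : ℕ
  D = ↧ₙ m ℕ.^ n ℕ.* n !
  instance
    D≢0 : NonZero D
    D≢0 = ℕₚ.m*n≢0 (↧ₙ m ℕ.^ n) (n !) {{ℕₚ.m^n≢0 (↧ₙ m) n}} {{ℕₚ._!≢0 n}}
  Δ^-binom : ∀ k → Δ^ k f 0 ≡ sumBelow (suc k) (λ j → sgn j * nat (k C j) * binom (m * nat k - m * nat j) n)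
  Δ^-binom k = trans (Δ^-explicit k f) (sumBelow-cong (suc k) λ where
    j (s≤s j≤k) → cong (λ y → sgn j * nat (k C j) * binom y n) (sym (*-nat-∸ m j≤k)))
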